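{- Let $\lambda/\mu$, $\nu/\rho$ be skew shapes, $D$ the shuffle diagram of shape $(\lambda/\mu)\circledast(\nu/\rho)$, and $S$ a Yamanouchi shuffle tableau of this shape. Then $\varphi^{ -1}(S)$ is a standard Young tableau.
   Context: English convention: $(i,j)$ is row $i$ (top to bottom), column $j$. The shuffle diagram $D$ has a square at $(2i-1,2j-1)$ for each square $(i,j)$ of $\lambda/\mu$ and at $(2i,2j)$ for each square $(i,j)$ of $\nu/\rho$. A shuffle tableau is a filling of $D$ by positive integers weakly increasing along rows of $D$ and strictly increasing down columns of $D$. For a shuffle tableau $S$ and $i\ge1$, an $(i,i+1)$-overlap is a pair of squares in the same column, one containing $i$ and the other $i+1$. The $i$-reading word $w_i(S)$ is obtained by taking the squares containing $i$ or $i+1$, deleting all squares in $(i,i+1)$-overlaps, and reading the rest row by row from the bottom row to the top row, each row left to right. Regarding each $i+1$ as "(" and each $i$ as ")" and matching parentheses in the usual way, $E_i$ can be applied to $S$ iff $w_i(S)$ contains an unmatched $i+1$; $S$ is Yamanouchi if no $E_i$ ($i\ge1$) can be applied. Label the $N$ squares of $D$ by $1,\ldots,N$ row by row from the top row to the bottom row, within each row from right to left. $\varphi^{ -1}(S)$ is the left-justified array whose row $r$ consists of the labels of the squares of $S$ containing $r$, arranged in increasing order from left to right. -}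

module Defs where

open import Data.Nat using (ℕ; zero; suc; _+_; _*_; _∸_; _≤_; _<_; _≡ᵇ_; _<ᵇ_; _≤ᵇ_; _⊔_; pred)
open import Data.Nat.DivMod using (_/_; _%_)
open import Data.Bool using (Bool; true; false; _∧_; _∨_; not; if_then_else_)
open import Data.List using (List; []; _∷_; length; map; reverse; concat; concatMap; filterᵇ; applyUpTo; zip; foldr)
open import Data.Nat.ListAction using (sum)
open import Data.Bool.ListAction using (any)
open import Data.Product using (_×_; _,_; proj₁; proj₂)
open import Relation.Binary.PropositionalEquality using (_≡_)
open import Relation.Nullary using (¬_)
open import Data.List.Relation.Binary.Permutation.Propositional using (_↭_)

range1 : ℕ → List ℕ
range1 n = applyUpTo suc n

-- 0-indexed lookup with default 0
part0 : List ℕ → ℕ → ℕ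
part0 []       _       = 0
part0 (x ∷ xs) zero    = x
part0 (x ∷ xs) (suc i) = part0 xs i

-- Partitions and skew shapes.  A partition is a weakly decreasing list of
-- naturals (λ_i = part0 λ (i-1), and 0 beyond the list).

IsPartition : List ℕ → Set
IsPartition la = ∀ i → part0 la (suc i) ≤ part0 la i

SkewShape : List ℕ → List ℕ → Set
SkewShape la mu = IsPartition la × IsPartition mu × (∀ i → part0 mu i ≤ part0 la i)

-- (i,j) (1-indexed, English convention) is a square of λ/μ
inSkew : List ℕ → List ℕ → ℕ → ℕ → Bool
inSkew la mu i j = (1 ≤ᵇ i) ∧ (part0 mu (i ∸ 1) <ᵇ j) ∧ (j ≤ᵇ part0 la (i ∸ 1))

-- The shuffle diagram D of shape (λ/μ) ⊛ (ν/ρ):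
-- square (2i-1,2j-1) for (i,j) ∈ λ/μ, square (2i,2j) for (i,j) ∈ ν/ρ.

isOdd : ℕ → Bool
isOdd n = n % 2 ≡ᵇ 1

inD : (la mu nu rho : List ℕ) → ℕ → ℕ → Bool
inD la mu nu rho r c =
  (isOdd r ∧ isOdd c ∧ inSkew la mu ((r + 1) / 2) ((c + 1) / 2))
  ∨ (not (isOdd r) ∧ not (isOdd c) ∧ inSkew nu rho (r / 2) (c / 2))

-- a bound on all row and column indices of squares of D
bound : (la mu nu rho : List ℕ) → ℕ
bound la mu nu rho = 2 * (sum la + sum nu + length la + length nu + 1)

-- The squares of D listed in label order: rows from top to bottom,
-- within each row from right to left.  The square at position k (0-based)
-- in this list has label k+1.
cellsD : (la mu nu rho : List ℕ) → List (ℕ × ℕ)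
cellsD la mu nu rho =
  concatMap (λ r → map (λ c → (r , c))
                       (filterᵇ (inD la mu nu rho r) (reverse (range1 B))))
            (range1 B)
  where B = bound la mu nu rho

-- Shuffle tableaux.  A filling is a function S : ℕ → ℕ → ℕ (row, column);
-- only its values on squares of D matter.

Filling : Set
Filling = ℕ → ℕ → ℕ

record ShuffleTableau (la mu nu rho : List ℕ) (S : Filling) : Set where
  field
    positive   : ∀ r c → inD la mu nu rho r c ≡ true → 1 ≤ S r c
    rowWeak    : ∀ r c c' → inD la mu nu rho r c ≡ true → inD la mu nu rho r c' ≡ true →
                 c < c' → S r c ≤ S r c'
    colStrict  : ∀ r r' c → inD la mu nu rho r c ≡ true → inD la mu nu rho r' c ≡ true →
                 r < r' → S r c < S r' c

inOverlap : (la mu nu rho : List ℕ) → Filling → ℕ → ℕ × ℕ → Bool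
inOverlap la mu nu rho S i (r , c) =
  any (λ rc' → (proj₂ rc' ≡ᵇ c) ∧ (S (proj₁ rc') (proj₂ rc') ≡ᵇ partner))
      (cellsD la mu nu rho)
  where partner = if S r c ≡ᵇ i then suc i else i

-- the i-reading word: squares containing i or i+1, not in an overlap,
-- read bottom row to top row, each row left to right
-- (= reverse of label order).
readingWord : (la mu nu rho : List ℕ) → Filling → ℕ → List ℕ
readingWord la mu nu rho S i =
  map (λ rc → S (proj₁ rc) (proj₂ rc))
      (filterᵇ (λ rc → ((S (proj₁ rc) (proj₂ rc) ≡ᵇ i) ∨ (S (proj₁ rc) (proj₂ rc) ≡ᵇ suc i))
                       ∧ not (inOverlap la mu nu rho S i rc))
               (reverse (cellsD la mu nu rho)))

-- number of unmatched "(" (= i+1) when i+1 is "(" and i is ")";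
-- k is the current number of open unmatched "("
unmatchedOpen : ℕ → ℕ → List ℕ → ℕ
unmatchedOpen i k []       = k
unmatchedOpen i k (x ∷ xs) =
  if x ≡ᵇ suc i then unmatchedOpen i (suc k) xs else unmatchedOpen i (pred k) xs

CanApplyE : (la mu nu rho : List ℕ) → Filling → ℕ → Set
CanApplyE la mu nu rho S i = 1 ≤ unmatchedOpen i 0 (readingWord la mu nu rho S i)

Yamanouchi : (la mu nu rho : List ℕ) → Filling → Set
Yamanouchi la mu nu rho S = ∀ i → 1 ≤ i → ¬ CanApplyE la mu nu rho S i

-- φ⁻¹(S): row r (r = 1 .. max entry) lists, increasingly, the labels of
-- squares of S containing r.  Row r is the (r-1)-th element of the list.

labelledCells : (la mu nu rho : List ℕ) → List (ℕ × (ℕ × ℕ))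
labelledCells la mu nu rho = zip (range1 (length cs)) cs
  where cs = cellsD la mu nu rho

maxEntry : (la mu nu rho : List ℕ) → Filling → ℕ
maxEntry la mu nu rho S = foldr _⊔_ 0 (map (λ rc → S (proj₁ rc) (proj₂ rc)) (cellsD la mu nu rho))

phiInv : (la mu nu rho : List ℕ) → Filling → List (List ℕ)
phiInv la mu nu rho S =
  map (λ r → map proj₁ (filterᵇ (λ kc → S (proj₁ (proj₂ kc)) (proj₂ (proj₂ kc)) ≡ᵇ r)
                                (labelledCells la mu nu rho)))
      (range1 (maxEntry la mu nu rho S))

-- Standard Young tableaux, as left-justified arrays (list of rows, top first).

rowAt : List (List ℕ) → ℕ → List ℕ
rowAt []       _       = []
rowAt (x ∷ xs) zero    = x
rowAt (x ∷ xs) (suc i) = rowAt xs i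

entry : List (List ℕ) → ℕ → ℕ → ℕ
entry T r c = part0 (rowAt T r) c

record StandardYoungTableau (T : List (List ℕ)) : Set where
  field
    shape     : ∀ r → length (rowAt T (suc r)) ≤ length (rowAt T r)
    rowIncr   : ∀ r c → suc c < length (rowAt T r) → entry T r c < entry T r (suc c)
    colIncr   : ∀ r c → c < length (rowAt T (suc r)) → entry T r c < entry T (suc r) c
    entries   : concat T ↭ range1 (length (concat T))

-- Read the squares of D in label order and record their entries.  In every prefix of this
-- word the letter i+1 occurs at most as often as i.  Outside (i,i+1)-overlaps this is the
-- absence of an unmatched i+1 in the i-reading word, which is this word restricted to those
-- squares and read backwards.  In an overlap, the i+1 of a column (there is at most one) has
-- its partner i above it, hence labelled earlier, so column by column the overlapping i+1's
-- of a prefix do not outnumber its overlapping i's.  φ⁻¹(S) is the recording tableau of this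
-- lattice word (row r lists the positions of the letter r), and such a tableau is standard:
-- rows increase because positions are listed in order, row lengths decrease by the count over
-- the whole word, and the c-th occurrence of r+1 is preceded by at least c occurrences of r,
-- so columns increase.
module Submission where

open import Defs
open import Data.Bool using (Bool; true; false; T; not; _∧_; _∨_; if_then_else_)
open import Data.Bool.Properties using (T-∧; T-≡; ∧-identityʳ; ∧-zeroʳ)
open import Data.Empty using (⊥-elim)
open import Data.List
  using (List; []; _∷_; _++_; length; map; concat; concatMap; filterᵇ; take; drop; reverse; zip;
         applyUpTo; foldr; deduplicate)
open import Data.List.Properties
  using (length-++; length-map; length-applyUpTo; map-++; map-∘; concat-map; filter-++; filter-some;
         filter-accept; filter-reject; filter-none; take-map; take-all; take++drop≡id; reverse-++;
         reverse-applyUpTo)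
open import Data.List.Membership.Propositional using (_∈_; find; lose)
open import Data.List.Membership.Propositional.Properties
  using (∈-filter⁻; ∈-map⁺; ∈-deduplicate⁺; ∈-applyUpTo⁺; ∈-++⁻; ∈-++⁺ˡ)
open import Data.List.Relation.Unary.All as All using (All; []; _∷_)
import Data.List.Relation.Unary.All.Properties as All
open import Data.List.Relation.Unary.AllPairs as AllPairs using (AllPairs; []; _∷_)
import Data.List.Relation.Unary.AllPairs.Properties as AllPairs
open import Data.List.Relation.Unary.Any using (Any; here; there)
open import Data.List.Relation.Unary.Any.Properties using (any⁺; any⁻)
open import Data.List.Relation.Unary.Unique.Propositional using (Unique)
open import Data.List.Relation.Binary.Permutation.Propositional
  using (_↭_; ↭-reflexive; ↭-sym; ↭-trans; prep; module PermutationReasoning)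
open import Data.List.Relation.Binary.Permutation.Propositional.Properties
  using (↭-length; ↭-reverse; filter-↭; map⁺; ++⁺ˡ; shift)
open import Data.Nat using (ℕ; zero; suc; pred; _+_; _≤_; _<_; _>_; _⊔_; z≤n; s≤s; _≡ᵇ_)
open import Data.Nat.Properties
  using (≤-refl; ≤-trans; ≤-pred; <⇒≤; <⇒≢; ≤⇒≯; ≰⇒>; n≮n; 1+n≢n; 1+n≰n; n<1⇒n≡0; suc-injective;
         +-suc; +-mono-≤; +-monoˡ-≤; m≤n+m; m≤m⊔n; m≤n⊔m; ≡ᵇ⇒≡; ≡⇒≡ᵇ; _≟_; module ≤-Reasoning)
open import Data.List.Relation.Unary.Unique.DecPropositional.Properties _≟_ using (deduplicate-!)
open import Data.Product using (_×_; _,_; proj₁; proj₂; ∃; uncurry)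
open import Data.Sum using (_⊎_; inj₁; inj₂)
open import Function using (_∘_; Equivalence)
open import Relation.Binary.PropositionalEquality
  using (_≡_; _≢_; refl; cong; cong₂; sym; trans; subst; subst₂; module ≡-Reasoning)
open import Relation.Nullary using (¬_)
open import Relation.Nullary.Decidable using (T?; dec-true; dec-false)

private variable
  A B : Set
  p q : A → Bool
  xs ys : List A

≡ᵇ-true : ∀ m n → m ≡ n → (m ≡ᵇ n) ≡ true
≡ᵇ-true m n = dec-true (m ≟ n)

≡ᵇ-false : ∀ m n → m ≢ n → (m ≡ᵇ n) ≡ false
≡ᵇ-false m n = dec-false (m ≟ n)

≡ᵇ-suc-disjoint : ∀ m a → (m ≡ᵇ a) ≡ true → (m ≡ᵇ suc a) ≡ false
≡ᵇ-suc-disjoint zero    zero    _  = refl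
≡ᵇ-suc-disjoint (suc m) (suc a) eq = ≡ᵇ-suc-disjoint m a eq

∨-∧-selectʳ : ∀ a b c → ((a ∨ b) ∧ c) ∧ b ≡ b ∧ c
∨-∧-selectʳ true  true  c = ∧-identityʳ c
∨-∧-selectʳ false true  c = ∧-identityʳ c
∨-∧-selectʳ a     false c = ∧-zeroʳ _

∨-∧-selectˡ : ∀ a b c → (a ≡ true → b ≡ false) → ((a ∨ b) ∧ c) ∧ not b ≡ a ∧ c
∨-∧-selectˡ true  false c _  = ∧-identityʳ c
∨-∧-selectˡ true  true  c ab with () ← ab refl
∨-∧-selectˡ false true  c _  = ∧-zeroʳ _
∨-∧-selectˡ false false c _  = refl

AllPairs-combine : ∀ {P : A → Set} {R Q : A → A → Set} →
                   (∀ {x y} → P x → P y → R x y → Q x y) → All P xs → AllPairs R xs → AllPairs Q xs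
AllPairs-combine f []         []         = []
AllPairs-combine f (px ∷ pxs) (rx ∷ rxs) =
  All.zipWith (λ (py , r) → f px py r) (pxs , rx) ∷ AllPairs-combine f pxs rxs

AllPairs-++⁻ : ∀ {R : A → A → Set} xs → AllPairs R (xs ++ ys) →
               AllPairs R xs × All (λ x → All (R x) ys) xs
AllPairs-++⁻ []       _          = [] , []
AllPairs-++⁻ (x ∷ xs) (rx ∷ rxs) with rxs′ , cross ← AllPairs-++⁻ xs rxs =
  All.++⁻ˡ xs rx ∷ rxs′ , All.++⁻ʳ xs rx ∷ cross

count : (A → Bool) → List A → ℕ
count p xs = length (filterᵇ p xs)

count-∷-true : ∀ (p : A → Bool) {x} xs → p x ≡ true → count p (x ∷ xs) ≡ suc (count p xs)
count-∷-true p xs px rewrite px = refl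

count-∷-false : ∀ (p : A → Bool) {x} xs → p x ≡ false → count p (x ∷ xs) ≡ count p xs
count-∷-false p xs px rewrite px = refl

count-++ : ∀ (p : A → Bool) xs ys → count p (xs ++ ys) ≡ count p xs + count p ys
count-++ p xs ys = trans (cong length (filter-++ (T? ∘ p) xs ys)) (length-++ (filterᵇ p xs))

count-↭ : ∀ (p : A → Bool) → xs ↭ ys → count p xs ≡ count p ys
count-↭ p xs↭ys = ↭-length (filter-↭ (T? ∘ p) xs↭ys)

count-map : ∀ (p : B → Bool) (g : A → B) xs → count p (map g xs) ≡ count (p ∘ g) xs
count-map p g []       = refl
count-map p g (x ∷ xs) with p (g x)
... | true  = cong suc (count-map p g xs)
... | false = count-map p g xs

count-filterᵇ : ∀ (p q : A → Bool) xs → count q (filterᵇ p xs) ≡ count (λ x → p x ∧ q x) xs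
count-filterᵇ p q []       = refl
count-filterᵇ p q (x ∷ xs) with p x
... | false = count-filterᵇ p q xs
... | true with q x
...   | true  = cong suc (count-filterᵇ p q xs)
...   | false = count-filterᵇ p q xs

count-cong : (∀ x → p x ≡ q x) → ∀ xs → count p xs ≡ count q xs
count-cong p≗q []       = refl
count-cong {p = p} {q = q} p≗q (x ∷ xs) with p x | q x | p≗q x
... | true  | true  | refl = cong suc (count-cong p≗q xs)
... | false | false | refl = count-cong p≗q xs

count-split : ∀ (p q : A → Bool) xs →
              count p xs ≡ count (λ x → p x ∧ q x) xs + count (λ x → p x ∧ not (q x)) xs
count-split p q []       = refl
count-split p q (x ∷ xs) with p x | q x
... | false | _     = count-split p q xs
... | true  | true  = cong suc (count-split p q xs)
... | true  | false = trans (cong suc (count-split p q xs)) (sym (+-suc _ _))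

exclusive⇒count≤1 : ∀ {R : A → A → Set} (p : A → Bool) {xs} → AllPairs R xs →
                    (∀ {x y} → T (p x) → T (p y) → ¬ R x y) → count p xs ≤ 1
exclusive⇒count≤1 {R = R} p {xs} rxs exclusive =
  length≤1 (filterᵇ p xs) (AllPairs.filter⁺ (T? ∘ p) rxs) (All.all-filter (T? ∘ p) xs)
  where
  length≤1 : ∀ zs → AllPairs R zs → All (T ∘ p) zs → length zs ≤ 1
  length≤1 []          _               _              = z≤n
  length≤1 (_ ∷ [])    _               _              = s≤s z≤n
  length≤1 (_ ∷ _ ∷ _) ((rxy ∷ _) ∷ _) (px ∷ py ∷ _) = ⊥-elim (exclusive px py rxy)

count≤1⇒count≤ : ∀ (p q : A → Bool) xs → count p xs ≤ 1 →
                 (∀ {x} → x ∈ xs → T (p x) → Any (T ∘ q) xs) → count p xs ≤ count q xs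
count≤1⇒count≤ p q xs ≤1 witness with filterᵇ p xs in eq
... | []    = z≤n
... | x ∷ _ with x∈xs , px ← ∈-filter⁻ (T? ∘ p) (subst (x ∈_) (sym eq) (here refl)) =
  ≤-trans ≤1 (filter-some (T? ∘ q) (witness x∈xs px))

gather : (A → ℕ) → List ℕ → List A → List A
gather key ks xs = concat (map (λ k → filterᵇ (λ x → key x ≡ᵇ k) xs) ks)

gather-[] : ∀ (key : A → ℕ) ks → gather key ks [] ≡ []
gather-[] key []       = refl
gather-[] key (k ∷ ks) = gather-[] key ks

gather-∉ : ∀ (key : A → ℕ) {ks x} xs → All (key x ≢_) ks → gather key ks (x ∷ xs) ≡ gather key ks xs
gather-∉ key xs []                      = refl
gather-∉ key {k ∷ _} xs (x≢k ∷ x∉ks) =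
  cong₂ _++_ (filter-reject (T? ∘ (λ y → key y ≡ᵇ k)) (x≢k ∘ ≡ᵇ⇒≡ _ _)) (gather-∉ key xs x∉ks)

gather-∈ : ∀ (key : A → ℕ) {ks x} xs → Unique ks → key x ∈ ks →
           gather key ks (x ∷ xs) ↭ x ∷ gather key ks xs
gather-∈ key {k ∷ ks} xs (k∉ks ∷ _) (here refl) = ↭-reflexive
  (cong₂ _++_ (filter-accept (T? ∘ (λ y → key y ≡ᵇ k)) (≡⇒≡ᵇ k k refl)) (gather-∉ key xs k∉ks))
gather-∈ key {k ∷ ks} {x} xs (k∉ks ∷ unique) (there x∈ks) = begin
  gather key (k ∷ ks) (x ∷ xs)
    ≡⟨ cong (_++ gather key ks (x ∷ xs)) (filter-reject (T? ∘ (λ y → key y ≡ᵇ k)) x≢k) ⟩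
  fibre ++ gather key ks (x ∷ xs)
    ↭⟨ ++⁺ˡ fibre (gather-∈ key xs unique x∈ks) ⟩
  fibre ++ x ∷ gather key ks xs
    ↭⟨ shift x fibre (gather key ks xs) ⟩
  x ∷ gather key (k ∷ ks) xs
    ∎
  where
  open PermutationReasoning
  fibre = filterᵇ (λ y → key y ≡ᵇ k) xs
  x≢k : ¬ T (key x ≡ᵇ k)
  x≢k = All.lookup k∉ks x∈ks ∘ sym ∘ ≡ᵇ⇒≡ _ _

gather-↭ : ∀ (key : A → ℕ) {ks} xs → Unique ks → All (λ x → key x ∈ ks) xs → gather key ks xs ↭ xs
gather-↭ key {ks} []       _      []              = ↭-reflexive (gather-[] key ks)
gather-↭ key      (x ∷ xs) unique (x∈ks ∷ xs∈ks) =
  ↭-trans (gather-∈ key xs unique x∈ks) (prep x (gather-↭ key xs unique xs∈ks))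

count-gather-≤ : ∀ (key : A → ℕ) (p q : A → Bool) ks xs →
  (∀ k → count p (filterᵇ (λ x → key x ≡ᵇ k) xs) ≤ count q (filterᵇ (λ x → key x ≡ᵇ k) xs)) →
  count p (gather key ks xs) ≤ count q (gather key ks xs)
count-gather-≤ key p q []       xs fibres = z≤n
count-gather-≤ key p q (k ∷ ks) xs fibres =
  subst₂ _≤_ (sym (count-++ p fibre (gather key ks xs))) (sym (count-++ q fibre (gather key ks xs)))
    (+-mono-≤ (fibres k) (count-gather-≤ key p q ks xs fibres))
  where fibre = filterᵇ (λ x → key x ≡ᵇ k) xs

count-≤-fibrewise : ∀ (key : A → ℕ) (p q : A → Bool) xs →
  (∀ k → count (λ x → (key x ≡ᵇ k) ∧ p x) xs ≤ count (λ x → (key x ≡ᵇ k) ∧ q x) xs) →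
  count p xs ≤ count q xs
count-≤-fibrewise key p q xs fibres = begin
  count p xs                  ≡⟨ count-↭ p (↭-sym regroup) ⟩
  count p (gather key ks xs)  ≤⟨ count-gather-≤ key p q ks xs fibres′ ⟩
  count q (gather key ks xs)  ≡⟨ count-↭ q regroup ⟩
  count q xs                  ∎
  where
  open ≤-Reasoning
  ks = deduplicate _≟_ (map key xs)
  regroup : gather key ks xs ↭ xs
  regroup = gather-↭ key xs (deduplicate-! (map key xs))
              (All.tabulate (λ x∈xs → ∈-deduplicate⁺ _≟_ (∈-map⁺ key x∈xs)))
  fibres′ : ∀ k → count p (filterᵇ (λ x → key x ≡ᵇ k) xs) ≤ count q (filterᵇ (λ x → key x ≡ᵇ k) xs)
  fibres′ k = subst₂ _≤_ (sym (count-filterᵇ _ p xs)) (sym (count-filterᵇ _ q xs)) (fibres k)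

Ballot : ℕ → (A → Bool) → (A → Bool) → List A → Set
Ballot k p q xs = ∀ n → count q (take n xs) ≤ k + count p (take n xs)

Ballot⇒count≤ : ∀ {k} xs → Ballot k p q xs → count q xs ≤ k + count p xs
Ballot⇒count≤ xs ballot =
  subst (λ ys → count _ ys ≤ _ + count _ ys) (take-all (length xs) xs ≤-refl) (ballot (length xs))

Ballot-map⁻ : ∀ {k} (g : B → A) xs → Ballot k p q (map g xs) → Ballot k (p ∘ g) (q ∘ g) xs
Ballot-map⁻ {p = p} {q = q} {k = k} g xs ballot n =
  subst₂ _≤_ (trans (cong (count q) (take-map n xs)) (count-map q g (take n xs)))
             (cong (k +_) (trans (cong (count p) (take-map n xs)) (count-map p g (take n xs))))
             (ballot n)

module _ {p q : A → Bool} {z : A} {zs : List A} where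

  Ballot-drop-p : ∀ {k} → p z ≡ true → q z ≡ false → Ballot k p q (z ∷ zs) → Ballot (suc k) p q zs
  Ballot-drop-p {k} pz qz ballot n rewrite sym (+-suc k (count p (take n zs))) =
    subst₂ _≤_ (count-∷-false q (take n zs) qz) (cong (k +_) (count-∷-true p (take n zs) pz))
      (ballot (suc n))

  Ballot-drop-q : ∀ {k} → p z ≡ false → q z ≡ true → Ballot (suc k) p q (z ∷ zs) → Ballot k p q zs
  Ballot-drop-q {k} pz qz ballot n = ≤-pred
    (subst₂ _≤_ (count-∷-true q (take n zs) qz) (cong (suc k +_) (count-∷-false p (take n zs) pz))
      (ballot (suc n)))

  Ballot-drop-other : ∀ {k} → p z ≡ false → q z ≡ false → Ballot k p q (z ∷ zs) → Ballot k p q zs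
  Ballot-drop-other {k} pz qz ballot n =
    subst₂ _≤_ (count-∷-false q (take n zs) qz) (cong (k +_) (count-∷-false p (take n zs) pz))
      (ballot (suc n))

  ¬Ballot₀-q∷ : p z ≡ false → q z ≡ true → ¬ Ballot 0 p q (z ∷ zs)
  ¬Ballot₀-q∷ pz qz ballot =
    1+n≰n (subst₂ _≤_ (count-∷-true q [] qz) (count-∷-false p [] pz) (ballot 1))

All-part0 : ∀ {P : ℕ → Set} {ns} i → All P ns → i < length ns → P (part0 ns i)
All-part0 zero    (pn ∷ _)   _        = pn
All-part0 (suc i) (_ ∷ pns) (s≤s i<) = All-part0 i pns i<

part0-< : ∀ {ns} i → AllPairs _<_ ns → suc i < length ns → part0 ns i < part0 ns (suc i)
part0-< zero    ((m<n ∷ _) ∷ _) (s≤s (s≤s _)) = m<n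
part0-< (suc i) (_ ∷ ns<)       (s≤s i<)      = part0-< i ns< i<

module _ (lab : B → ℕ) {p q : B → Bool} (disjoint : ∀ z → p z ≡ true → q z ≡ false) where

  Ballot⇒part0< : ∀ k zs → AllPairs (λ x y → lab x < lab y) zs → Ballot k p q zs →
    ∀ d → k + d < length (map lab (filterᵇ q zs)) →
    part0 (map lab (filterᵇ p zs)) d < part0 (map lab (filterᵇ q zs)) (k + d)
  Ballot⇒part0< k (z ∷ zs) (z< ∷ zs<) ballot d lt with p z in pz | q z in qz
  ... | true  | true  with () ← trans (sym qz) (disjoint z pz)
  ... | true  | false with d
  ...   | zero  = All-part0 {P = lab z <_} (k + 0) (All.map⁺ (All.filter⁺ (T? ∘ q) z<)) lt
  ...   | suc d rewrite +-suc k d = Ballot⇒part0< (suc k) zs zs< (Ballot-drop-p pz qz ballot) d lt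
  Ballot⇒part0< zero    (z ∷ zs) _         ballot d lt       | false | true =
    ⊥-elim (¬Ballot₀-q∷ pz qz ballot)
  Ballot⇒part0< (suc k) (z ∷ zs) (_ ∷ zs<) ballot d (s≤s lt) | false | true =
    Ballot⇒part0< k zs zs< (Ballot-drop-q pz qz ballot) d lt
  Ballot⇒part0< k       (z ∷ zs) (_ ∷ zs<) ballot d lt       | false | false =
    Ballot⇒part0< k zs zs< (Ballot-drop-other pz qz ballot) d lt

positions : (A → Bool) → List A → List ℕ
positions p xs = map proj₁ (filterᵇ (p ∘ proj₂) (zip (range1 (length xs)) xs))

recordingTableau : (A → ℕ) → ℕ → List A → List (List ℕ)
recordingTableau val M xs = map (λ r → positions (λ x → val x ≡ᵇ r) xs) (range1 M)

map-proj₁-zip : ∀ (xs : List A) (ys : List B) → length xs ≡ length ys → map proj₁ (zip xs ys) ≡ xs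
map-proj₁-zip []       []       _  = refl
map-proj₁-zip (x ∷ xs) (y ∷ ys) eq = cong (x ∷_) (map-proj₁-zip xs ys (suc-injective eq))

map-proj₂-zip : ∀ (xs : List A) (ys : List B) → length xs ≡ length ys → map proj₂ (zip xs ys) ≡ ys
map-proj₂-zip []       []       _  = refl
map-proj₂-zip (x ∷ xs) (y ∷ ys) eq = cong (y ∷_) (map-proj₂-zip xs ys (suc-injective eq))

rowAt-map-applyUpTo : ∀ (g : ℕ → List ℕ) f M → (∀ r → M ≤ r → g (f r) ≡ []) →
                      ∀ r → rowAt (map g (applyUpTo f M)) r ≡ g (f r)
rowAt-map-applyUpTo g f zero    beyond r       = sym (beyond r z≤n)
rowAt-map-applyUpTo g f (suc M) beyond zero    = refl
rowAt-map-applyUpTo g f (suc M) beyond (suc r) =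
  rowAt-map-applyUpTo g (f ∘ suc) M (λ r M≤r → beyond (suc r) (s≤s M≤r)) r

range1-sorted : ∀ n → AllPairs _<_ (range1 n)
range1-sorted n = AllPairs.applyUpTo⁺₁ suc n (λ i<j _ → s≤s i<j)

∈-range1 : ∀ {v n} → 1 ≤ v → v ≤ n → v ∈ range1 n
∈-range1 {suc v} (s≤s _) v<n = ∈-applyUpTo⁺ suc v<n

module _ (val : A → ℕ) (M : ℕ) (xs : List A)
         (inRange : All (λ x → 1 ≤ val x × val x ≤ M) xs)
         (lattice : ∀ i → 1 ≤ i → Ballot 0 (λ x → val x ≡ᵇ i) (λ x → val x ≡ᵇ suc i) xs) where

  private
    n = length xs
    labelled = zip (range1 n) xs
    T′ = recordingTableau val M xs

    row : ℕ → List ℕ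
    row r = positions (λ x → val x ≡ᵇ r) xs

    labels : map proj₁ labelled ≡ range1 n
    labels = map-proj₁-zip (range1 n) xs (length-applyUpTo suc n)

    items : map proj₂ labelled ≡ xs
    items = map-proj₂-zip (range1 n) xs (length-applyUpTo suc n)

    labelled-sorted : AllPairs (λ x y → proj₁ x < proj₁ y) labelled
    labelled-sorted = AllPairs.map⁻ (subst (AllPairs _<_) (sym labels) (range1-sorted n))

    labelled-inRange : All (λ z → 1 ≤ val (proj₂ z) × val (proj₂ z) ≤ M) labelled
    labelled-inRange = All.map⁻ (subst (All _) (sym items) inRange)

    labelled-lattice : ∀ i → 1 ≤ i →
      Ballot 0 (λ z → val (proj₂ z) ≡ᵇ i) (λ z → val (proj₂ z) ≡ᵇ suc i) labelled
    labelled-lattice i i≥1 = Ballot-map⁻ proj₂ labelled (subst (Ballot 0 _ _) (sym items) (lattice i i≥1))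

    length-row : ∀ r → length (row r) ≡ count (λ z → val (proj₂ z) ≡ᵇ r) labelled
    length-row r = length-map proj₁ (filterᵇ (λ z → val (proj₂ z) ≡ᵇ r) labelled)

    row-beyond : ∀ r → M < r → row r ≡ []
    row-beyond r M<r = cong (map proj₁) (filter-none (T? ∘ _)
      (All.map (λ (_ , v≤M) v≡r → ≤⇒≯ (subst (_≤ M) (≡ᵇ⇒≡ _ _ v≡r) v≤M) M<r) labelled-inRange))

    rowAt-T′ : ∀ r → rowAt T′ r ≡ row (suc r)
    rowAt-T′ = rowAt-map-applyUpTo row suc M (λ r M≤r → row-beyond (suc r) (s≤s M≤r))

    shape : ∀ r → length (rowAt T′ (suc r)) ≤ length (rowAt T′ r)
    shape r rewrite rowAt-T′ r | rowAt-T′ (suc r) =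
      subst₂ _≤_ (sym (length-row (suc (suc r)))) (sym (length-row (suc r)))
        (Ballot⇒count≤ labelled (labelled-lattice (suc r) (s≤s z≤n)))

    rowIncr : ∀ r c → suc c < length (rowAt T′ r) → entry T′ r c < entry T′ r (suc c)
    rowIncr r c lt rewrite rowAt-T′ r =
      part0-< c (AllPairs.map⁺ (AllPairs.filter⁺ (T? ∘ _) labelled-sorted)) lt

    colIncr : ∀ r c → c < length (rowAt T′ (suc r)) → entry T′ r c < entry T′ (suc r) c
    colIncr r c lt rewrite rowAt-T′ r | rowAt-T′ (suc r) =
      Ballot⇒part0< proj₁ (λ z → ≡ᵇ-suc-disjoint (val (proj₂ z)) (suc r))
        0 labelled labelled-sorted (labelled-lattice (suc r) (s≤s z≤n)) c lt

    concat-↭-range1 : concat T′ ↭ range1 n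
    concat-↭-range1 = begin
      concat T′                                             ≡⟨ cong concat (map-∘ (range1 M)) ⟩
      concat (map (map proj₁) (map byValue (range1 M)))     ≡⟨ concat-map (map byValue (range1 M)) ⟩
      map proj₁ (gather (val ∘ proj₂) (range1 M) labelled)  ↭⟨ map⁺ proj₁ regroup ⟩
      map proj₁ labelled                                    ≡⟨ labels ⟩
      range1 n                                              ∎
      where
      open PermutationReasoning
      byValue : ℕ → List (ℕ × A)
      byValue r = filterᵇ (λ z → val (proj₂ z) ≡ᵇ r) labelled
      regroup : gather (val ∘ proj₂) (range1 M) labelled ↭ labelled
      regroup = gather-↭ (val ∘ proj₂) labelled (AllPairs.map <⇒≢ (range1-sorted M))
                  (All.map (λ (1≤v , v≤M) → ∈-range1 1≤v v≤M) labelled-inRange)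

    length-concat : length (concat T′) ≡ n
    length-concat = trans (↭-length concat-↭-range1) (length-applyUpTo suc n)

  recordingTableau-standard : StandardYoungTableau (recordingTableau val M xs)
  recordingTableau-standard = record
    { shape   = shape
    ; rowIncr = rowIncr
    ; colIncr = colIncr
    ; entries = subst (λ m → concat T′ ↭ range1 m) (sym length-concat) concat-↭-range1
    }

unmatchedOpen-++ : ∀ i k u w → unmatchedOpen i k (u ++ w) ≡ unmatchedOpen i (unmatchedOpen i k u) w
unmatchedOpen-++ i k []      w = refl
unmatchedOpen-++ i k (x ∷ u) w with x ≡ᵇ suc i
... | true  = unmatchedOpen-++ i (suc k) u w
... | false = unmatchedOpen-++ i (pred k) u w

unmatchedOpen-lowerBound : ∀ i k w →
  k + count (_≡ᵇ suc i) w ≤ unmatchedOpen i k w + count (not ∘ (_≡ᵇ suc i)) w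
unmatchedOpen-lowerBound i k []      = ≤-refl
unmatchedOpen-lowerBound i k (x ∷ w) with x ≡ᵇ suc i
... | true  rewrite +-suc k (count (_≡ᵇ suc i) w) = unmatchedOpen-lowerBound i (suc k) w
... | false = begin
  k + count (_≡ᵇ suc i) w
    ≤⟨ +-monoˡ-≤ _ (k≤suc-pred k) ⟩
  suc (pred k + count (_≡ᵇ suc i) w)
    ≤⟨ s≤s (unmatchedOpen-lowerBound i (pred k) w) ⟩
  suc (unmatchedOpen i (pred k) w + count (not ∘ (_≡ᵇ suc i)) w)
    ≡⟨ +-suc _ _ ⟨
  unmatchedOpen i (pred k) w + suc (count (not ∘ (_≡ᵇ suc i)) w)
    ∎
  where
  open ≤-Reasoning
  k≤suc-pred : ∀ k → k ≤ suc (pred k)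
  k≤suc-pred zero    = z≤n
  k≤suc-pred (suc k) = ≤-refl

balanced⇒suffix-count≤ : ∀ i u w → unmatchedOpen i 0 (u ++ w) ≡ 0 →
  count (_≡ᵇ suc i) w ≤ count (not ∘ (_≡ᵇ suc i)) w
balanced⇒suffix-count≤ i u w balanced = begin
  count (_≡ᵇ suc i) w
    ≤⟨ m≤n+m _ k ⟩
  k + count (_≡ᵇ suc i) w
    ≤⟨ unmatchedOpen-lowerBound i k w ⟩
  unmatchedOpen i k w + count (not ∘ (_≡ᵇ suc i)) w
    ≡⟨ cong (_+ _) (trans (sym (unmatchedOpen-++ i 0 u w)) balanced) ⟩
  count (not ∘ (_≡ᵇ suc i)) w
    ∎
  where
  open ≤-Reasoning
  k = unmatchedOpen i 0 u

_labelledBefore_ : ℕ × ℕ → ℕ × ℕ → Set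
(r , c) labelledBefore (r′ , c′) = r < r′ ⊎ (r ≡ r′ × c′ < c)

module _ (L : ℕ → List ℕ) where

  All-rowwise : ∀ {P : ℕ → ℕ → Set} rs → (∀ r → All (P r) (L r)) →
                All (uncurry P) (concatMap (λ r → map (λ c → (r , c)) (L r)) rs)
  All-rowwise rs allL = All.concat⁺ (All.map⁺ (All.universal (λ r → All.map⁺ (allL r)) rs))

  rowwise-labelledBefore : ∀ rs → AllPairs _<_ rs → (∀ r → AllPairs _>_ (L r)) →
                           AllPairs _labelledBefore_ (concatMap (λ r → map (λ c → (r , c)) (L r)) rs)
  rowwise-labelledBefore rs rs< L> = AllPairs.concat⁺
    (All.map⁺ (All.universal
      (λ r → AllPairs.map⁺ (AllPairs.map (λ c>c′ → inj₂ (refl , c>c′)) (L> r))) rs))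
    (AllPairs.map⁺ (AllPairs.map (λ {r} {r′} r<r′ →
       All.map⁺ (All.universal (λ _ → All.map⁺ (All.universal (λ _ → inj₁ r<r′) (L r′))) (L r))) rs<))

module _ (la mu nu rho : List ℕ) where

  private
    N = bound la mu nu rho

    squaresInRow : ℕ → List ℕ
    squaresInRow r = filterᵇ (inD la mu nu rho r) (reverse (range1 N))

  cellsD-inD : All (λ x → T (inD la mu nu rho (proj₁ x) (proj₂ x))) (cellsD la mu nu rho)
  cellsD-inD = All-rowwise squaresInRow (range1 N)
    (λ r → All.all-filter (T? ∘ inD la mu nu rho r) (reverse (range1 N)))

  cellsD-labelledBefore : AllPairs _labelledBefore_ (cellsD la mu nu rho)
  cellsD-labelledBefore = rowwise-labelledBefore squaresInRow (range1 N) (range1-sorted N)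
    (λ r → AllPairs.filter⁺ (T? ∘ inD la mu nu rho r)
             (subst (AllPairs _>_) (sym (reverse-applyUpTo suc N))
                    (AllPairs.applyDownFrom⁺₁ suc N (λ j<i _ → s≤s j<i))))

module _ (la mu nu rho : List ℕ) (S : Filling) (st : ShuffleTableau la mu nu rho S) where

  open ShuffleTableau st

  cellsD-columnIncreasing :
    AllPairs (λ x y → proj₂ x ≡ proj₂ y → uncurry S x < uncurry S y) (cellsD la mu nu rho)
  cellsD-columnIncreasing =
    AllPairs-combine below (cellsD-inD la mu nu rho) (cellsD-labelledBefore la mu nu rho)
    where
    below : ∀ {x y} → T (inD la mu nu rho (proj₁ x) (proj₂ x)) →
            T (inD la mu nu rho (proj₁ y) (proj₂ y)) → x labelledBefore y →
            proj₂ x ≡ proj₂ y → uncurry S x < uncurry S y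
    below {r , c} {r′ , .c} x∈D y∈D (inj₁ r<r′)        refl =
      colStrict r r′ c (Equivalence.to T-≡ x∈D) (Equivalence.to T-≡ y∈D) r<r′
    below                   _   _   (inj₂ (_ , c′<c)) refl = ⊥-elim (n≮n _ c′<c)

module _ (la mu nu rho : List ℕ) (S : Filling) (st : ShuffleTableau la mu nu rho S) (i : ℕ)
         (balanced : unmatchedOpen i 0 (readingWord la mu nu rho S i) ≡ 0) where

  private
    cs = cellsD la mu nu rho
    f = uncurry S
    col : ℕ × ℕ → ℕ
    col = proj₂
    ov : ℕ × ℕ → Bool
    ov = inOverlap la mu nu rho S i

    inWord : ℕ × ℕ → Bool
    inWord x = ((f x ≡ᵇ i) ∨ (f x ≡ᵇ suc i)) ∧ not (ov x)

    partner : ℕ → ℕ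
    partner v = if v ≡ᵇ i then suc i else i

    partner-suc : partner (suc i) ≡ i
    partner-suc rewrite ≡ᵇ-false (suc i) i 1+n≢n = refl

    partner-i : partner i ≡ suc i
    partner-i rewrite ≡ᵇ-true i i refl = refl

    overlap⁻ : ∀ x → f x ≡ suc i → T (ov x) → ∃ λ y → y ∈ cs × col y ≡ col x × f y ≡ i
    overlap⁻ x fx≡ ovx with y , y∈cs , match ← find (any⁻ _ cs ovx)
                       with same-col , fy≡partner ← Equivalence.to T-∧ match =
      y , y∈cs , ≡ᵇ⇒≡ _ _ same-col , trans (≡ᵇ⇒≡ _ _ fy≡partner) (trans (cong partner fx≡) partner-suc)

    overlap⁺ : ∀ {x y} → x ∈ cs → col x ≡ col y → f x ≡ suc i → f y ≡ i → T (ov y)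
    overlap⁺ {x} {y} x∈cs same-col fx≡ fy≡ = any⁺ _ (lose x∈cs (Equivalence.from T-∧
      (≡⇒≡ᵇ _ _ same-col , ≡⇒≡ᵇ _ _ (trans fx≡ (sym (trans (cong partner fy≡) partner-i))))))

    overlappingAt : ℕ → ℕ → ℕ × ℕ → Bool
    overlappingAt c v x = (col x ≡ᵇ c) ∧ ((f x ≡ᵇ v) ∧ ov x)

    overlappingAt⁻ : ∀ {c v x} → T (overlappingAt c v x) → col x ≡ c × f x ≡ v × T (ov x)
    overlappingAt⁻ t with c≡ , rest ← Equivalence.to T-∧ t
                     with v≡ , ovx ← Equivalence.to T-∧ rest = ≡ᵇ⇒≡ _ _ c≡ , ≡ᵇ⇒≡ _ _ v≡ , ovx

    overlappingAt⁺ : ∀ {c v x} → col x ≡ c → f x ≡ v → T (ov x) → T (overlappingAt c v x)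
    overlappingAt⁺ c≡ v≡ ovx =
      Equivalence.from T-∧ (≡⇒≡ᵇ _ _ c≡ , Equivalence.from T-∧ (≡⇒≡ᵇ _ _ v≡ , ovx))

  nonOverlapping-count≤ : ∀ as bs → as ++ bs ≡ cs →
    count (λ x → (f x ≡ᵇ suc i) ∧ not (ov x)) as ≤ count (λ x → (f x ≡ᵇ i) ∧ not (ov x)) as
  nonOverlapping-count≤ as bs split =
    subst₂ _≤_
      (trans (countWord (_≡ᵇ suc i))
             (count-cong (λ x → ∨-∧-selectʳ (f x ≡ᵇ i) (f x ≡ᵇ suc i) (not (ov x))) as))
      (trans (countWord (not ∘ (_≡ᵇ suc i)))
             (count-cong (λ x → ∨-∧-selectˡ (f x ≡ᵇ i) (f x ≡ᵇ suc i) (not (ov x))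
                                            (≡ᵇ-suc-disjoint (f x) i)) as))
      (balanced⇒suffix-count≤ i (map f (filterᵇ inWord (reverse bs))) (map f (filterᵇ inWord (reverse as)))
        (trans (cong (unmatchedOpen i 0) (sym readingWord-split)) balanced))
    where
    readingWord-split : readingWord la mu nu rho S i ≡
                        map f (filterᵇ inWord (reverse bs)) ++ map f (filterᵇ inWord (reverse as))
    readingWord-split = begin
      map f (filterᵇ inWord (reverse cs))
        ≡⟨ cong (map f ∘ filterᵇ inWord ∘ reverse) (sym split) ⟩
      map f (filterᵇ inWord (reverse (as ++ bs)))
        ≡⟨ cong (map f ∘ filterᵇ inWord) (reverse-++ as bs) ⟩
      map f (filterᵇ inWord (reverse bs ++ reverse as))
        ≡⟨ cong (map f) (filter-++ (T? ∘ inWord) (reverse bs) (reverse as)) ⟩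
      map f (filterᵇ inWord (reverse bs) ++ filterᵇ inWord (reverse as))
        ≡⟨ map-++ f (filterᵇ inWord (reverse bs)) _ ⟩
      map f (filterᵇ inWord (reverse bs)) ++ map f (filterᵇ inWord (reverse as))
        ∎
      where open ≡-Reasoning

    countWord : ∀ q → count q (map f (filterᵇ inWord (reverse as))) ≡ count (λ x → inWord x ∧ q (f x)) as
    countWord q = begin
      count q (map f (filterᵇ inWord (reverse as)))  ≡⟨ count-map q f (filterᵇ inWord (reverse as)) ⟩
      count (q ∘ f) (filterᵇ inWord (reverse as))    ≡⟨ count-filterᵇ inWord (q ∘ f) (reverse as) ⟩
      count (λ x → inWord x ∧ q (f x)) (reverse as)  ≡⟨ count-↭ _ (↭-reverse as) ⟩
      count (λ x → inWord x ∧ q (f x)) as            ∎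
      where open ≡-Reasoning

  overlapping-count≤ : ∀ as bs → as ++ bs ≡ cs →
    count (λ x → (f x ≡ᵇ suc i) ∧ ov x) as ≤ count (λ x → (f x ≡ᵇ i) ∧ ov x) as
  overlapping-count≤ as bs split = count-≤-fibrewise col _ _ as perColumn
    where
    increasing : AllPairs (λ x y → col x ≡ col y → f x < f y) (as ++ bs)
    increasing = subst (AllPairs _) (sym split) (cellsD-columnIncreasing la mu nu rho S st)

    perColumn : ∀ c → count (overlappingAt c (suc i)) as ≤ count (overlappingAt c i) as
    perColumn c = count≤1⇒count≤ _ _ as
      (exclusive⇒count≤1 _ (proj₁ (AllPairs-++⁻ as increasing)) exclusive) witness
      where
      exclusive : ∀ {x y} → T (overlappingAt c (suc i) x) → T (overlappingAt c (suc i) y) →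
                  ¬ (col x ≡ col y → f x < f y)
      exclusive px py increase with cx , fx , _ ← overlappingAt⁻ px | cy , fy , _ ← overlappingAt⁻ py =
        n≮n (suc i) (subst₂ _<_ fx fy (increase (trans cx (sym cy))))

      witness : ∀ {x} → x ∈ as → T (overlappingAt c (suc i) x) → Any (T ∘ overlappingAt c i) as
      witness {x} x∈as px with cx , fx , ovx ← overlappingAt⁻ px
                          with y , y∈cs , cy , fy ← overlap⁻ x fx ovx
                          with ∈-++⁻ as (subst (y ∈_) (sym split) y∈cs)
      ... | inj₁ y∈as = lose y∈as
              (overlappingAt⁺ (trans cy cx) fy
                (overlap⁺ (subst (x ∈_) split (∈-++⁺ˡ x∈as)) (sym cy) fx fy))
      ... | inj₂ y∈bs = ⊥-elim (1+n≰n (<⇒≤ (subst₂ _<_ fx fy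
              (All.lookup (All.lookup (proj₂ (AllPairs-++⁻ as increasing)) x∈as) y∈bs (sym cy)))))

  balanced⇒Ballot : Ballot 0 (λ x → f x ≡ᵇ i) (λ x → f x ≡ᵇ suc i) cs
  balanced⇒Ballot n = begin
    count (λ x → f x ≡ᵇ suc i) as
      ≡⟨ count-split _ ov as ⟩
    count (λ x → (f x ≡ᵇ suc i) ∧ ov x) as + count (λ x → (f x ≡ᵇ suc i) ∧ not (ov x)) as
      ≤⟨ +-mono-≤ (overlapping-count≤ as bs split) (nonOverlapping-count≤ as bs split) ⟩
    count (λ x → (f x ≡ᵇ i) ∧ ov x) as + count (λ x → (f x ≡ᵇ i) ∧ not (ov x)) as
      ≡⟨ count-split _ ov as ⟨
    count (λ x → f x ≡ᵇ i) as
      ∎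
    where
    open ≤-Reasoning
    as = take n cs
    bs = drop n cs
    split = take++drop≡id n cs

All-≤-foldr-⊔ : ∀ ns → All (_≤ foldr _⊔_ 0 ns) ns
All-≤-foldr-⊔ []       = []
All-≤-foldr-⊔ (n ∷ ns) = m≤m⊔n n _ ∷ All.map (λ le → ≤-trans le (m≤n⊔m n _)) (All-≤-foldr-⊔ ns)

lemma2p16 : (la mu nu rho : List ℕ) → SkewShape la mu → SkewShape nu rho →
            (S : Filling) → ShuffleTableau la mu nu rho S → Yamanouchi la mu nu rho S →
            StandardYoungTableau (phiInv la mu nu rho S)
lemma2p16 la mu nu rho _ _ S st yam =
  -- phiInv la mu nu rho S unfolds to recordingTableau (uncurry S) (maxEntry la mu nu rho S) cs.
  recordingTableau-standard (uncurry S) (maxEntry la mu nu rho S) cs inRange lattice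
  where
  open ShuffleTableau st
  cs = cellsD la mu nu rho

  inRange : All (λ x → 1 ≤ uncurry S x × uncurry S x ≤ maxEntry la mu nu rho S) cs
  inRange = All.zipWith (λ (x∈D , x≤max) → positive _ _ (Equivalence.to T-≡ x∈D) , x≤max)
              (cellsD-inD la mu nu rho , All.map⁻ (All-≤-foldr-⊔ (map (uncurry S) cs)))

  lattice : ∀ i → 1 ≤ i → Ballot 0 (λ x → uncurry S x ≡ᵇ i) (λ x → uncurry S x ≡ᵇ suc i) cs
  lattice i i≥1 = balanced⇒Ballot la mu nu rho S st i (n<1⇒n≡0 (≰⇒> (yam i i≥1)))
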